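{- Suppose that there exists a GDP$(M,3^{e_1}2^{e_2})$. Let $w_1=e_1+e_2$, $w_2$ and $w_3$ be integers such that $w_1\geq w_2\geq w_3$ and $w_2+w_3=2e_1+e_2$. Then there exists a $\overline{w}$-balanced $(M,3)$-packing of size $n$, where $n=w_1M$ and $\overline{w}=(w_1, w_2,w_3)$.
   Context: A GDP$(M,3^{e_1}2^{e_2})$ (generalized difference packing) is a collection of $e_1$ subsets of size $3$ and $e_2$ subsets of size $2$ of $\mathbb{Z}_M$ (base blocks) such that every nonzero element of $\mathbb{Z}_M$ occurs at most once among all differences $b-b'$ ($b\neq b'$ in the same base block). For a composition $\overline{w}=(w_1,w_2,w_3)$ with total weight $w$ and $\lambda=\lceil w/w_1\rceil$, a $\overline{w}$-balanced $(M,3)$-packing of size $n$ is a set $\mathcal{A}$ of $n$ triples in $(\mathbb{Z}_M\cup\{*\})^{3}$ such that (T1) in each triple the non-$*$ entries are distinct and the sets of non-$*$ entries form an $(M,\{\lambda,\lambda-1\})$-packing on $\mathbb{Z}_M$ (blocks of size $\lambda$ or $\lambda-1$, each pair of $\mathbb{Z}_M$ in at most one block), and (T2) for each position $i\in[3]$, each element of $\mathbb{Z}_M$ occurs in position $i$ exactly $w_i$ times in $\mathcal{A}$. -}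

module Defs where

open import Data.Nat using (ℕ; zero; suc; _+_; _*_; _∸_; _≤_; NonZero)
open import Data.Nat.DivMod using (_mod_; _/_)
open import Data.Fin using (Fin; toℕ)
open import Data.Fin.Properties using (any?)
import Data.Fin as F
open import Data.Maybe using (Maybe; just; nothing; is-just)
open import Data.Maybe.Properties using (≡-dec)
open import Data.Bool using (T)
open import Data.List using (List; []; _∷_; _++_; length; filter; concat)
import Data.List.Membership.Propositional
open import Data.List.Relation.Unary.Unique.Propositional using (Unique)
open import Data.Vec.Functional using (Vector)
open import Data.Vec using (Vec; toList)
import Data.Vec as V
open import Data.Product using (Σ; ∃; ∃-syntax; _×_; _,_)
open import Data.Sum using (_⊎_)
open import Function.Definitions using (Injective)
open import Relation.Binary.PropositionalEquality using (_≡_; _≢_)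
open import Relation.Nullary using (Dec; ¬_)
open import Relation.Nullary.Decidable using (_×-dec_; T?)

_⊖_ : {M : ℕ} .{{_ : NonZero M}} → Fin M → Fin M → Fin M
_⊖_ {M} a b = (toℕ a + (M ∸ toℕ b)) mod M

-- A k-subset of ℤ_M is represented by an injective map Fin k → ℤ_M
-- (an enumeration of its elements); the list of differences does not
-- depend on the enumeration chosen.

diffs3 : {M : ℕ} .{{_ : NonZero M}} → Vector (Fin M) 3 → List (Fin M)
diffs3 B = let a = B F.zero ; b = B (F.suc F.zero) ; c = B (F.suc (F.suc F.zero)) in
  (a ⊖ b) ∷ (b ⊖ a) ∷ (a ⊖ c) ∷ (c ⊖ a) ∷ (b ⊖ c) ∷ (c ⊖ b) ∷ []

diffs2 : {M : ℕ} .{{_ : NonZero M}} → Vector (Fin M) 2 → List (Fin M)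
diffs2 B = (B F.zero ⊖ B (F.suc F.zero)) ∷ (B (F.suc F.zero) ⊖ B F.zero) ∷ []

record GDP (M : ℕ) .{{_ : NonZero M}} (e₁ e₂ : ℕ) : Set where
  field
    blocks3   : Vec (Vector (Fin M) 3) e₁
    blocks2   : Vec (Vector (Fin M) 2) e₂
    blocks3-subset : ∀ i → Injective _≡_ _≡_ (V.lookup blocks3 i)
    blocks2-subset : ∀ i → Injective _≡_ _≡_ (V.lookup blocks2 i)
    differences-unique :
      Unique (concat (toList (V.map diffs3 blocks3)) ++ concat (toList (V.map diffs2 blocks2)))

-- a triple in (ℤ_M ∪ {*})³ ; nothing = *
Triple : ℕ → Set
Triple M = Vector (Maybe (Fin M)) 3

-- ⌈ w / w₁ ⌉ ; the value for w₁ = 0 is irrelevant (then n = 0)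
⌈_/_⌉ : ℕ → ℕ → ℕ
⌈ w / zero ⌉ = 0
⌈ w / suc k ⌉ = (w + k) / suc k

blockSize : {M : ℕ} → Triple M → ℕ
blockSize t = length (filter (λ k → T? (is-just (t k))) (V.toList (V.allFin 3)))

_∈ᵗ_ : {M : ℕ} → Fin M → Triple M → Set
x ∈ᵗ t = ∃[ k ] t k ≡ just x

_∈ᵗ?_ : {M : ℕ} (x : Fin M) (t : Triple M) → Dec (x ∈ᵗ t)
x ∈ᵗ? t = any? (λ k → ≡-dec F._≟_ (t k) (just x))

pairCount : {M : ℕ} → Fin M → Fin M → List (Triple M) → ℕ
pairCount x y 𝒜 = length (filter (λ t → (x ∈ᵗ? t) ×-dec (y ∈ᵗ? t)) 𝒜)

posCount : {M : ℕ} → Fin 3 → Fin M → List (Triple M) → ℕ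
posCount i x 𝒜 = length (filter (λ t → ≡-dec F._≟_ (t i) (just x)) 𝒜)

-- 𝒜 (a list, i.e. a collection with multiplicity) is a
-- (w₁,w₂,w₃)-balanced (M,3)-packing
record Balanced (M : ℕ) (w : Vector ℕ 3) (𝒜 : List (Triple M)) : Set where
  λ′ : ℕ
  λ′ = ⌈ (w F.zero + w (F.suc F.zero) + w (F.suc (F.suc F.zero))) / w F.zero ⌉
  field
    distinct  : ∀ t → Data.List.Membership.Propositional._∈_ t 𝒜 →
                ∀ k l (x : Fin M) → t k ≡ just x → t l ≡ just x → k ≡ l
    sizes     : ∀ t → Data.List.Membership.Propositional._∈_ t 𝒜 →
                blockSize t ≡ λ′ ⊎ blockSize t ≡ λ′ ∸ 1
    packing   : ∀ (x y : Fin M) → x ≢ y → pairCount x y 𝒜 ≤ 1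
    positions : ∀ (i : Fin 3) (x : Fin M) → posCount i x 𝒜 ≡ w i

module Submission where

-- A GDP(M,3^e₁2^e₂) is developed cyclically over ℤ_M: each
-- base block B is turned into a triple of (ℤ_M ∪ {*})³, possibly with one
-- '*', and this base triple is translated by every s ∈ ℤ_M.  A 3-subset
-- {a,b,c} gives the base triple (a,b,c); of the e₂ 2-subsets {a,b}, the
-- first k give (a,b,*) and the remaining r give (a,*,b), where k and r are
-- read off from w₂ = e₁ + k, w₃ = e₁ + r.

module Counting where

  open import Data.Nat using (ℕ; suc; _+_; _≤_; z≤n; s≤s)
  open import Data.Nat.Properties using (≤-antisym; ≤-trans; ≤-reflexive; n≤1+n; +-suc; +-monoʳ-≤)
  open import Data.List using (List; []; _∷_; _++_; length; filter; map)
  open import Data.List.Properties using (filter-++; filter-none; filter-some; length-++)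
  open import Data.List.Relation.Unary.All using (All)
  import Data.List.Relation.Unary.All as All
  import Data.List.Relation.Unary.Any as Any
  open import Data.List.Relation.Unary.AllPairs using (_∷_)
  open import Data.List.Relation.Unary.Unique.Propositional using (Unique)
  open import Data.List.Membership.Propositional using (_∈_)
  open import Data.Bool using (true; false)
  open import Data.Empty using (⊥-elim)
  open import Level using (Level)
  open import Relation.Nullary using (¬_; yes; no; does)
  open import Relation.Nullary.Decidable using (_⊎-dec_)
  open import Relation.Unary using (Pred; Decidable)
  open import Relation.Binary.PropositionalEquality using (_≡_; refl; sym; trans; cong; subst)

  private variable
    a b p q : Level
    A B : Set a

  count : {P : Pred A p} → Decidable P → List A → ℕ
  count P? xs = length (filter P? xs)

  module _ {P : Pred A p} (P? : Decidable P) where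

    count-++ : ∀ xs ys → count P? (xs ++ ys) ≡ count P? xs + count P? ys
    count-++ xs ys = trans (cong length (filter-++ P? xs ys)) (length-++ (filter P? xs))

    count-map : (f : B → A) (xs : List B) → count P? (map f xs) ≡ count (λ y → P? (f y)) xs
    count-map f [] = refl
    count-map f (x ∷ xs) with does (P? (f x))
    ... | true = cong suc (count-map f xs)
    ... | false = count-map f xs

    count-none : ∀ {xs} → All (λ x → ¬ P x) xs → count P? xs ≡ 0
    count-none none = cong length (filter-none P? none)

    count-unique≤1 : ∀ {xs} → Unique xs → (∀ {x y} → P x → P y → x ≡ y) → count P? xs ≤ 1
    count-unique≤1 {[]} _ _ = z≤n
    count-unique≤1 {x ∷ xs} (x∉xs ∷ unique) at-most-one with P? x
    ... | no _ = count-unique≤1 unique at-most-one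
    ... | yes px = s≤s (≤-reflexive (count-none (All.map (λ x≢y py → x≢y (at-most-one px py)) x∉xs)))

    count-unique≡1 : ∀ {x xs} → Unique xs → x ∈ xs → P x → (∀ {x y} → P x → P y → x ≡ y) →
                     count P? xs ≡ 1
    count-unique≡1 unique x∈xs px at-most-one =
      ≤-antisym (count-unique≤1 unique at-most-one)
                (filter-some P? (Any.map (λ x≡y → subst _ x≡y px) x∈xs))

  module _ {P : Pred A p} {Q : Pred A q} (P? : Decidable P) (Q? : Decidable Q) where

    count-mono : (∀ {x} → P x → Q x) → ∀ xs → count P? xs ≤ count Q? xs
    count-mono P⇒Q [] = z≤n
    count-mono P⇒Q (x ∷ xs) with P? x | Q? x
    ... | yes _  | yes _ = s≤s (count-mono P⇒Q xs)
    ... | yes px | no ¬qx = ⊥-elim (¬qx (P⇒Q px))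
    ... | no _   | yes _ = ≤-trans (count-mono P⇒Q xs) (n≤1+n _)
    ... | no _   | no _  = count-mono P⇒Q xs

    count-⊎ : ∀ xs → count (λ x → P? x ⊎-dec Q? x) xs ≤ count P? xs + count Q? xs
    count-⊎ [] = z≤n
    count-⊎ (x ∷ xs) with P? x | Q? x
    ... | yes _ | yes _ = s≤s (≤-trans (count-⊎ xs) (+-monoʳ-≤ (count P? xs) (n≤1+n _)))
    ... | yes _ | no _  = s≤s (count-⊎ xs)
    ... | no _  | yes _ = ≤-trans (s≤s (count-⊎ xs)) (≤-reflexive (sym (+-suc _ _)))
    ... | no _  | no _  = count-⊎ xs

module ModularArithmetic where

  open import Defs using (_⊖_)
  open import Data.Nat using (ℕ; _+_; _∸_; NonZero)
  open import Data.Nat.Properties using (+-comm; +-assoc; m+[n∸m]≡n; <⇒≤)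
  open import Data.Nat.DivMod using (_%_; _mod_; %-distribˡ-+; m%n%n≡m%n; [m+n]%n≡m%n; m%n<n; m<n⇒m%n≡m)
  open import Data.Fin using (Fin; toℕ)
  open import Data.Fin.Properties using (toℕ-injective; toℕ-fromℕ<; toℕ<n)
  open import Function.Definitions using (Injective)
  open import Relation.Binary.PropositionalEquality using (_≡_; trans; cong; module ≡-Reasoning)
  open ≡-Reasoning

  module _ {M : ℕ} .{{_ : NonZero M}} where

    infixl 6 _⊕_
    _⊕_ : Fin M → Fin M → Fin M
    a ⊕ b = (toℕ a + toℕ b) mod M

    toℕ-mod : ∀ n → toℕ (n mod M) ≡ n % M
    toℕ-mod n = toℕ-fromℕ< (m%n<n n M)

    toℕ-% : (a : Fin M) → toℕ a % M ≡ toℕ a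
    toℕ-% a = m<n⇒m%n≡m (toℕ<n a)

    %-absorbˡ : ∀ m n → (m % M + n) % M ≡ (m + n) % M
    %-absorbˡ m n = begin
      (m % M + n) % M          ≡⟨ %-distribˡ-+ (m % M) n M ⟩
      (m % M % M + n % M) % M  ≡⟨ cong (λ u → (u + n % M) % M) (m%n%n≡m%n m M) ⟩
      (m % M + n % M) % M      ≡⟨ %-distribˡ-+ m n M ⟨
      (m + n) % M              ∎

    %-absorbʳ : ∀ m n → (m + n % M) % M ≡ (m + n) % M
    %-absorbʳ m n = begin
      (m + n % M) % M  ≡⟨ cong (_% M) (+-comm m (n % M)) ⟩
      (n % M + m) % M  ≡⟨ %-absorbˡ n m ⟩
      (n + m) % M      ≡⟨ cong (_% M) (+-comm n m) ⟩
      (m + n) % M      ∎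

    -- adding toℕ b and M ∸ toℕ b adds M, which vanishes modulo M
    %-complement : (b : Fin M) (u : ℕ) → (toℕ b + u + (M ∸ toℕ b)) % M ≡ u % M
    %-complement b u = begin
      (toℕ b + u + (M ∸ toℕ b)) % M    ≡⟨ cong (λ v → (v + (M ∸ toℕ b)) % M) (+-comm (toℕ b) u) ⟩
      (u + toℕ b + (M ∸ toℕ b)) % M    ≡⟨ cong (_% M) (+-assoc u (toℕ b) _) ⟩
      (u + (toℕ b + (M ∸ toℕ b))) % M  ≡⟨ cong (λ v → (u + v) % M) (m+[n∸m]≡n (<⇒≤ (toℕ<n b))) ⟩
      (u + M) % M                      ≡⟨ [m+n]%n≡m%n u M ⟩
      u % M                            ∎

    ⊕-comm : ∀ a b → a ⊕ b ≡ b ⊕ a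
    ⊕-comm a b = cong (_mod M) (+-comm (toℕ a) (toℕ b))

    ⊕-assoc : ∀ a b c → a ⊕ b ⊕ c ≡ a ⊕ (b ⊕ c)
    ⊕-assoc a b c = toℕ-injective (begin
      toℕ (a ⊕ b ⊕ c)                        ≡⟨ toℕ-mod _ ⟩
      (toℕ (a ⊕ b) + toℕ c) % M              ≡⟨ cong (λ u → (u + toℕ c) % M) (toℕ-mod _) ⟩
      ((toℕ a + toℕ b) % M + toℕ c) % M      ≡⟨ %-absorbˡ (toℕ a + toℕ b) (toℕ c) ⟩
      (toℕ a + toℕ b + toℕ c) % M            ≡⟨ cong (_% M) (+-assoc (toℕ a) (toℕ b) (toℕ c)) ⟩
      (toℕ a + (toℕ b + toℕ c)) % M          ≡⟨ %-absorbʳ (toℕ a) (toℕ b + toℕ c) ⟨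
      (toℕ a + (toℕ b + toℕ c) % M) % M      ≡⟨ cong (λ u → (toℕ a + u) % M) (toℕ-mod _) ⟨
      (toℕ a + toℕ (b ⊕ c)) % M              ≡⟨ toℕ-mod _ ⟨
      toℕ (a ⊕ (b ⊕ c))                      ∎)

    ⊕-⊖ : ∀ b x → b ⊕ (x ⊖ b) ≡ x
    ⊕-⊖ b x = toℕ-injective (begin
      toℕ (b ⊕ (x ⊖ b))                              ≡⟨ toℕ-mod _ ⟩
      (toℕ b + toℕ (x ⊖ b)) % M                      ≡⟨ cong (λ u → (toℕ b + u) % M) (toℕ-mod _) ⟩
      (toℕ b + (toℕ x + (M ∸ toℕ b)) % M) % M        ≡⟨ %-absorbʳ (toℕ b) _ ⟩
      (toℕ b + (toℕ x + (M ∸ toℕ b))) % M            ≡⟨ cong (_% M) (+-assoc (toℕ b) (toℕ x) _) ⟨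
      (toℕ b + toℕ x + (M ∸ toℕ b)) % M              ≡⟨ %-complement b (toℕ x) ⟩
      toℕ x % M                                      ≡⟨ toℕ-% x ⟩
      toℕ x                                          ∎)

    ⊖-⊕ : ∀ a s → (a ⊕ s) ⊖ a ≡ s
    ⊖-⊕ a s = toℕ-injective (begin
      toℕ ((a ⊕ s) ⊖ a)                              ≡⟨ toℕ-mod _ ⟩
      (toℕ (a ⊕ s) + (M ∸ toℕ a)) % M                ≡⟨ cong (λ u → (u + (M ∸ toℕ a)) % M) (toℕ-mod _) ⟩
      ((toℕ a + toℕ s) % M + (M ∸ toℕ a)) % M        ≡⟨ %-absorbˡ (toℕ a + toℕ s) _ ⟩
      (toℕ a + toℕ s + (M ∸ toℕ a)) % M              ≡⟨ %-complement a (toℕ s) ⟩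
      toℕ s % M                                      ≡⟨ toℕ-% s ⟩
      toℕ s                                          ∎)

    ⊕-cancelˡ : ∀ a {s t} → a ⊕ s ≡ a ⊕ t → s ≡ t
    ⊕-cancelˡ a {s} {t} eq = begin
      s            ≡⟨ ⊖-⊕ a s ⟨
      (a ⊕ s) ⊖ a  ≡⟨ cong (_⊖ a) eq ⟩
      (a ⊕ t) ⊖ a  ≡⟨ ⊖-⊕ a t ⟩
      t            ∎

    ⊕-injectiveʳ : ∀ s → Injective _≡_ _≡_ (_⊕ s)
    ⊕-injectiveʳ s {a} {b} eq = ⊕-cancelˡ s (trans (⊕-comm s a) (trans eq (⊕-comm b s)))

    ⊖-translate : ∀ a b s → (a ⊕ s) ⊖ (b ⊕ s) ≡ a ⊖ b
    ⊖-translate a b s = ⊕-cancelˡ (b ⊕ s) (begin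
      (b ⊕ s) ⊕ ((a ⊕ s) ⊖ (b ⊕ s))  ≡⟨ ⊕-⊖ (b ⊕ s) (a ⊕ s) ⟩
      a ⊕ s                          ≡⟨ cong (_⊕ s) (⊕-⊖ b a) ⟨
      b ⊕ (a ⊖ b) ⊕ s                ≡⟨ ⊕-assoc b (a ⊖ b) s ⟩
      b ⊕ ((a ⊖ b) ⊕ s)              ≡⟨ cong (b ⊕_) (⊕-comm (a ⊖ b) s) ⟩
      b ⊕ (s ⊕ (a ⊖ b))              ≡⟨ ⊕-assoc b s (a ⊖ b) ⟨
      (b ⊕ s) ⊕ (a ⊖ b)              ∎)

module Development where

  open import Defs
  open Counting
  open ModularArithmetic
  open import Data.Nat using (ℕ; _+_; _*_; _∸_; _≤_; NonZero)
  open import Data.Nat.Properties using (≤-reflexive; ≤-trans; +-mono-≤; module ≤-Reasoning)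
  open import Data.Nat.ListAction using (sum)
  open import Data.Bool using (T)
  open import Data.Fin using (Fin) renaming (zero to 0F; suc to sF)
  import Data.Fin as F
  open import Data.Maybe using (Maybe; just; nothing; is-just)
  import Data.Maybe as Maybe
  open import Data.Maybe.Properties using (≡-dec; just-injective; map-injective)
  open import Data.List using (List; []; _∷_; _++_; length; map; concatMap; allFin)
  open import Data.List.Properties using (filter-≐; length-map; length-tabulate; length-++)
  open import Data.List.Relation.Unary.All using (All)
  import Data.List.Relation.Unary.All as All
  open import Data.List.Relation.Unary.All.Properties using (map⁺; concat⁺)
  open import Data.List.Relation.Unary.Any using (Any; here; there; any?; toSum)
  import Data.List.Relation.Unary.Any as Any
  open import Data.List.Relation.Unary.Unique.Propositional using (Unique)
  open import Data.List.Relation.Unary.Unique.Propositional.Properties using (allFin⁺)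
  open import Data.List.Membership.Propositional using (_∈_)
  open import Data.List.Membership.Propositional.Properties using (∈-allFin)
  import Data.Vec as V
  open import Data.Vec.Functional using (Vector)
  open import Data.Product using (∃-syntax; _×_; _,_)
  open import Data.Sum using (_⊎_)
  open import Data.Empty using (⊥-elim)
  open import Function.Definitions using (Injective)
  open import Relation.Nullary using (Dec; yes; no)
  open import Relation.Nullary.Decidable using (_×-dec_; _⊎-dec_; T?)
  open import Relation.Binary.PropositionalEquality using (_≡_; _≢_; refl; sym; trans; cong; cong₂; subst)

  pattern 1F = sF 0F
  pattern 2F = sF (sF 0F)

  Distinct : {A : Set} → (Fin 3 → Maybe A) → Set
  Distinct t = ∀ k l x → t k ≡ just x → t l ≡ just x → k ≡ l

  just-preimage : {A B : Set} {f : A → B} (m : Maybe A) {y : B} → Maybe.map f m ≡ just y → ∃[ x ] m ≡ just x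
  just-preimage (just x) _ = x , refl

  distinct-map : {A B : Set} {f : A → B} {t : Fin 3 → Maybe A} →
                 Injective _≡_ _≡_ f → Distinct t → Distinct (λ k → Maybe.map f (t k))
  distinct-map {t = t} f-inj distinct k l y fk fl =
    let (x , tk≡x) = just-preimage (t k) fk
        tk≡tl = map-injective f-inj (trans fk (sym fl))
    in distinct k l x tk≡x (trans (sym tk≡tl) tk≡x)

  is-just-map : {A B : Set} (f : A → B) (m : Maybe A) → is-just (Maybe.map f m) ≡ is-just m
  is-just-map f (just _) = refl
  is-just-map f nothing = refl

  blockSize-map : {M N : ℕ} (f : Fin M → Fin N) (t : Triple M) → blockSize (λ k → Maybe.map f (t k)) ≡ blockSize t
  blockSize-map f t = cong length (filter-≐ (λ k → T? (is-just (Maybe.map f (t k)))) (λ k → T? (is-just (t k)))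
    ((λ {k} → subst T (is-just-map f (t k))) , (λ {k} → subst T (sym (is-just-map f (t k)))))
    (V.toList (V.allFin 3)))

  FitsLimit : {M : ℕ} → ℕ → Triple M → Set
  FitsLimit λ′ t = blockSize t ≡ λ′ ⊎ blockSize t ≡ λ′ ∸ 1

  limit : Vector ℕ 3 → ℕ
  limit w = ⌈ (w 0F + w 1F + w 2F) / w 0F ⌉

  filled : {A : Set} → Maybe A → ℕ
  filled (just _) = 1
  filled nothing = 0

  column : {M : ℕ} → Fin 3 → List (Triple M) → ℕ
  column i L = sum (map (λ τ → filled (τ i)) L)

  diff : {M : ℕ} .{{_ : NonZero M}} → Maybe (Fin M) → Maybe (Fin M) → List (Fin M)
  diff (just a) (just b) = a ⊖ b ∷ []
  diff (just _) nothing = []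
  diff nothing _ = []

  -- the ordered pairs of distinct positions, in the order used by diffs3
  orderedPairs : List (Fin 3 × Fin 3)
  orderedPairs = (0F , 1F) ∷ (1F , 0F) ∷ (0F , 2F) ∷ (2F , 0F) ∷ (1F , 2F) ∷ (2F , 1F) ∷ []

  orderedPairs-complete : ∀ k l → k ≢ l → (k , l) ∈ orderedPairs
  orderedPairs-complete 0F 1F _ = here refl
  orderedPairs-complete 1F 0F _ = there (here refl)
  orderedPairs-complete 0F 2F _ = there (there (here refl))
  orderedPairs-complete 2F 0F _ = there (there (there (here refl)))
  orderedPairs-complete 1F 2F _ = there (there (there (there (here refl))))
  orderedPairs-complete 2F 1F _ = there (there (there (there (there (here refl)))))
  orderedPairs-complete 0F 0F k≢l = ⊥-elim (k≢l refl)
  orderedPairs-complete 1F 1F k≢l = ⊥-elim (k≢l refl)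
  orderedPairs-complete 2F 2F k≢l = ⊥-elim (k≢l refl)

  pairDiff : {M : ℕ} .{{_ : NonZero M}} → Triple M → Fin 3 × Fin 3 → List (Fin M)
  pairDiff τ (k , l) = diff (τ k) (τ l)

  differences : {M : ℕ} .{{_ : NonZero M}} → Triple M → List (Fin M)
  differences τ = concatMap (pairDiff τ) orderedPairs

  module _ {M : ℕ} .{{_ : NonZero M}} where

    shift : Triple M → Fin M → Triple M
    shift τ s k = Maybe.map (_⊕ s) (τ k)

    development : Triple M → List (Triple M)
    development τ = map (shift τ) (allFin M)

    develop : List (Triple M) → List (Triple M)
    develop = concatMap development

    distinct-shift : ∀ τ s → Distinct τ → Distinct (shift τ s)
    distinct-shift τ s = distinct-map (⊕-injectiveʳ s)

    fits-shift : ∀ {lim} τ s → FitsLimit lim τ → FitsLimit lim (shift τ s)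
    fits-shift {lim} τ s = subst (λ n → n ≡ lim ⊎ n ≡ lim ∸ 1) (sym (blockSize-map (_⊕ s) τ))

    entry-hits : (x : Fin M) (u : Maybe (Fin M)) →
                 count (λ s → ≡-dec F._≟_ (Maybe.map (_⊕ s) u) (just x)) (allFin M) ≡ filled u
    entry-hits x nothing = count-none _ (All.universal (λ s ()) (allFin M))
    entry-hits x (just a) = count-unique≡1 _ (allFin⁺ M) (∈-allFin (x ⊖ a)) (cong just (⊕-⊖ a x))
      (λ ax as′x → ⊕-cancelˡ a (just-injective (trans ax (sym as′x))))

    pair-hits : (x y : Fin M) (u v : Maybe (Fin M)) →
      count (λ s → ≡-dec F._≟_ (Maybe.map (_⊕ s) u) (just x) ×-dec ≡-dec F._≟_ (Maybe.map (_⊕ s) v) (just y))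
            (allFin M)
      ≤ count (λ d → d F.≟ (x ⊖ y)) (diff u v)
    pair-hits x y nothing v = ≤-reflexive (count-none _ (All.universal (λ s ()) (allFin M)))
    pair-hits x y (just a) nothing = ≤-reflexive (count-none _ (All.universal (λ s ()) (allFin M)))
    pair-hits x y (just a) (just b) with a ⊖ b F.≟ x ⊖ y
    ... | yes _ = count-unique≤1 _ (allFin⁺ M) (λ (ax , _) (as′x , _) → ⊕-cancelˡ a (just-injective (trans ax (sym as′x))))
    ... | no ab≢xy = ≤-reflexive (count-none _ (All.universal (λ s (ax , by) → ab≢xy (same-difference s ax by)) (allFin M)))
      where
      same-difference : ∀ s → just (a ⊕ s) ≡ just x → just (b ⊕ s) ≡ just y → a ⊖ b ≡ x ⊖ y
      same-difference s ax by = trans (sym (⊖-translate a b s)) (cong₂ _⊖_ (just-injective ax) (just-injective by))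

    development-column : ∀ i x τ → posCount i x (development τ) ≡ filled (τ i)
    development-column i x τ = trans (count-map (λ t → ≡-dec F._≟_ (t i) (just x)) (shift τ) (allFin M)) (entry-hits x (τ i))

    development-length : ∀ τ → length (development τ) ≡ M
    development-length τ = trans (length-map (shift τ) (allFin M)) (length-tabulate (λ s → s))

    -- a translate containing the distinct points x and y witnesses an
    -- occurrence of the difference x - y in the base triple
    development-pairs : ∀ {x y} → x ≢ y → ∀ τ →
                        pairCount x y (development τ) ≤ count (λ d → d F.≟ (x ⊖ y)) (differences τ)
    development-pairs {x} {y} x≢y τ = begin
      pairCount x y (development τ)                                       ≡⟨ count-map _ (shift τ) (allFin M) ⟩
      count (λ s → (x ∈ᵗ? shift τ s) ×-dec (y ∈ᵗ? shift τ s)) (allFin M)  ≤⟨ count-mono _ _ meets-pair (allFin M) ⟩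
      count (λ s → any? (hit? s) orderedPairs) (allFin M)                 ≤⟨ hits≤ orderedPairs ⟩
      count (λ d → d F.≟ (x ⊖ y)) (differences τ)                         ∎
      where
      open ≤-Reasoning
      Hit : Fin M → Fin 3 × Fin 3 → Set
      Hit s (k , l) = shift τ s k ≡ just x × shift τ s l ≡ just y
      hit? : ∀ s p → Dec (Hit s p)
      hit? s (k , l) = ≡-dec F._≟_ (shift τ s k) (just x) ×-dec ≡-dec F._≟_ (shift τ s l) (just y)
      meets-pair : ∀ {s} → x ∈ᵗ shift τ s × y ∈ᵗ shift τ s → Any (Hit s) orderedPairs
      meets-pair ((k , kx) , (l , ly)) = Any.map (λ { refl → kx , ly })
        (orderedPairs-complete k l λ { refl → x≢y (just-injective (trans (sym kx) ly)) })
      hits≤ : ∀ ps → count (λ s → any? (hit? s) ps) (allFin M) ≤ count (λ d → d F.≟ (x ⊖ y)) (concatMap (pairDiff τ) ps)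
      hits≤ [] = ≤-reflexive (count-none _ (All.universal (λ s ()) (allFin M)))
      hits≤ ((k , l) ∷ ps) = begin
        count (λ s → any? (hit? s) ((k , l) ∷ ps)) (allFin M)
          ≤⟨ count-mono _ _ toSum (allFin M) ⟩
        count (λ s → hit? s (k , l) ⊎-dec any? (hit? s) ps) (allFin M)
          ≤⟨ count-⊎ _ _ (allFin M) ⟩
        count (λ s → hit? s (k , l)) (allFin M) + count (λ s → any? (hit? s) ps) (allFin M)
          ≤⟨ +-mono-≤ (pair-hits x y (τ k) (τ l)) (hits≤ ps) ⟩
        count (λ d → d F.≟ (x ⊖ y)) (diff (τ k) (τ l)) + count (λ d → d F.≟ (x ⊖ y)) (concatMap (pairDiff τ) ps)
          ≡⟨ count-++ _ (diff (τ k) (τ l)) _ ⟨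
        count (λ d → d F.≟ (x ⊖ y)) (concatMap (pairDiff τ) ((k , l) ∷ ps))
          ∎

    develop-length : ∀ L → length (develop L) ≡ length L * M
    develop-length [] = refl
    develop-length (τ ∷ L) = trans (length-++ (development τ)) (cong₂ _+_ (development-length τ) (develop-length L))

    develop-column : ∀ i x L → posCount i x (develop L) ≡ column i L
    develop-column i x [] = refl
    develop-column i x (τ ∷ L) = trans (count-++ _ (development τ) (develop L))
      (cong₂ _+_ (development-column i x τ) (develop-column i x L))

    develop-pairs : ∀ {x y} → x ≢ y → ∀ L → pairCount x y (develop L) ≤ count (λ d → d F.≟ (x ⊖ y)) (concatMap differences L)
    develop-pairs x≢y [] = ≤-reflexive refl
    develop-pairs {x} {y} x≢y (τ ∷ L) = begin
      pairCount x y (development τ ++ develop L)                                  ≡⟨ count-++ _ (development τ) (develop L) ⟩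
      pairCount x y (development τ) + pairCount x y (develop L)                   ≤⟨ +-mono-≤ (development-pairs x≢y τ) (develop-pairs x≢y L) ⟩
      count _≟xy (differences τ) + count _≟xy (concatMap differences L)           ≡⟨ count-++ _ (differences τ) _ ⟨
      count _≟xy (differences τ ++ concatMap differences L)                       ∎
      where
      open ≤-Reasoning
      _≟xy : ∀ d → Dec (d ≡ x ⊖ y)
      d ≟xy = d F.≟ (x ⊖ y)

    develop-all : {P : Triple M → Set} → (∀ τ s → P τ → P (shift τ s)) → ∀ {L} → All P L → All P (develop L)
    develop-all preserve all = concat⁺ (map⁺ (All.map (λ {τ} pτ → map⁺ (All.universal (λ s → preserve τ s pτ) (allFin M))) all))

    developed-packing : (w : Vector ℕ 3) (L : List (Triple M)) →
      All Distinct L → All (FitsLimit (limit w)) L → Unique (concatMap differences L) →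
      (∀ i → column i L ≡ w i) → Balanced M w (develop L)
    developed-packing w L distinct fits unique columns = record
      { distinct  = λ t t∈ → All.lookup (develop-all {P = Distinct} distinct-shift distinct) t∈
      ; sizes     = λ t t∈ → All.lookup (develop-all {P = FitsLimit (limit w)} fits-shift fits) t∈
      ; packing   = λ x y x≢y → ≤-trans (develop-pairs x≢y L) (count-unique≤1 _ unique (λ d≡ d′≡ → trans d≡ (sym d′≡)))
      ; positions = λ i x → trans (develop-column i x L) (columns i)
      }

module GDPBaseTriples where

  open import Defs
  open Development
  open import Data.Nat using (ℕ; zero; suc; _+_; _*_; _∸_; _⊓_; _≤_; _<_; z≤n; s≤s; NonZero)
  open import Data.Nat.Properties
  open import Data.Nat.DivMod using (_/_; +-distrib-/-∣ʳ; m<n⇒m/n≡0; m*n/n≡m)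
  open import Data.Nat.Divisibility using (n∣m*n)
  open import Data.Nat.ListAction using (sum)
  open import Data.Nat.ListAction.Properties using (sum-++)
  open import Data.Nat.Tactic.RingSolver using (solve-∀)
  open import Data.Fin using (Fin) renaming (zero to 0F)
  open import Data.Fin.Properties using (toℕ<n)
  open import Data.Maybe using (Maybe; just; nothing)
  import Data.Maybe as Maybe
  open import Data.Maybe.Properties using (just-injective)
  open import Data.List using (List; []; _∷_; _++_; length; map; concat; concatMap; take; drop)
  open import Data.List.Properties using (length-++; length-map; length-take; length-drop; map-++;
    concatMap-++; concatMap-map; take++drop≡id)
  open import Data.List.Relation.Unary.All using (All)
  import Data.List.Relation.Unary.All as All
  open import Data.List.Relation.Unary.All.Properties using (map⁺; ++⁺; take⁺; drop⁺)
  open import Data.List.Relation.Unary.Unique.Propositional using (Unique)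
  open import Data.Vec using (toList)
  import Data.Vec as V
  open import Data.Vec.Properties using (toList-map; length-toList)
  open import Data.Vec.Relation.Unary.All.Properties using (lookup⁻; toList⁺)
  open import Data.Vec.Functional using (Vector) renaming ([] to []ᵛ; _∷_ to _∷ᵛ_)
  open import Data.Product using (Σ; _×_; _,_)
  open import Data.Sum using (_⊎_; inj₁; inj₂)
  open import Function.Definitions using (Injective)
  open import Relation.Binary.PropositionalEquality using (_≡_; refl; sym; trans; cong; cong₂; subst; module ≡-Reasoning)
  open ≡-Reasoning

  ⌈/⌉-unique : ∀ W d q r → r ≤ d → W + d ≡ r + q * suc d → ⌈ W / suc d ⌉ ≡ q
  ⌈/⌉-unique W d q r r≤d W+d≡ = begin
    (W + d) / suc d                   ≡⟨ cong (_/ suc d) W+d≡ ⟩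
    (r + q * suc d) / suc d           ≡⟨ +-distrib-/-∣ʳ r (n∣m*n q) ⟩
    r / suc d + q * suc d / suc d     ≡⟨ cong₂ _+_ (m<n⇒m/n≡0 (s≤s r≤d)) (m*n/n≡m q (suc d)) ⟩
    q                                 ∎

  -- with at least one 3-subset, λ = ⌈(3e₁ + 2e₂)/(e₁ + e₂)⌉ = 3
  limit-with-triples : ∀ {e₁ e₂ w₂ w₃} → w₂ + w₃ ≡ 2 * e₁ + e₂ → 0 < e₁ →
                       limit ((e₁ + e₂) ∷ᵛ w₂ ∷ᵛ w₃ ∷ᵛ []ᵛ) ≡ 3
  limit-with-triples {suc a} {e₂} {w₂} {w₃} total (s≤s z≤n) =
    ⌈/⌉-unique (suc a + e₂ + w₂ + w₃) (a + e₂) 3 a (m≤m+n a e₂) (begin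
    suc a + e₂ + w₂ + w₃ + (a + e₂)          ≡⟨ cong (_+ (a + e₂)) (+-assoc (suc a + e₂) w₂ w₃) ⟩
    suc a + e₂ + (w₂ + w₃) + (a + e₂)        ≡⟨ cong (λ v → suc a + e₂ + v + (a + e₂)) total ⟩
    suc a + e₂ + (2 * suc a + e₂) + (a + e₂) ≡⟨ arith a e₂ ⟩
    a + 3 * suc (a + e₂)                     ∎)
    where
    arith : ∀ a e → suc a + e + (2 * suc a + e) + (a + e) ≡ a + 3 * suc (a + e)
    arith = solve-∀

  -- with at least one 2-subset, blocks of size 2 are admissible:
  -- λ = 3 if there are 3-subsets, λ = ⌈2e₂/e₂⌉ = 2 otherwise
  limit-with-pairs : ∀ {e₁ e₂ w₂ w₃} → w₂ + w₃ ≡ 2 * e₁ + e₂ → 0 < e₂ →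
                     let lim = limit ((e₁ + e₂) ∷ᵛ w₂ ∷ᵛ w₃ ∷ᵛ []ᵛ) in 2 ≡ lim ⊎ 2 ≡ lim ∸ 1
  limit-with-pairs {suc a} {e₂} {w₂} {w₃} total _ =
    inj₂ (sym (cong (_∸ 1) (limit-with-triples {suc a} {e₂} {w₂} {w₃} total (s≤s z≤n))))
  limit-with-pairs {zero} {suc b} {w₂} {w₃} total _ = inj₁ (sym (⌈/⌉-unique (suc b + w₂ + w₃) b 2 b ≤-refl (begin
    suc b + w₂ + w₃ + b        ≡⟨ cong (_+ b) (+-assoc (suc b) w₂ w₃) ⟩
    suc b + (w₂ + w₃) + b      ≡⟨ cong (λ v → suc b + v + b) total ⟩
    suc b + suc b + b          ≡⟨ arith b ⟩
    b + 2 * suc b              ∎)))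
    where
    arith : ∀ b → suc b + suc b + b ≡ b + 2 * suc b
    arith = solve-∀

  -- the hypotheses on w₂, w₃ give a splitting e₂ = k + r with
  -- w₂ = e₁ + k and w₃ = e₁ + r (note e₁ ≤ w₃ ≤ w₂)
  weight-split : ∀ {e₁ e₂ w₂ w₃} → w₂ ≤ e₁ + e₂ → w₃ ≤ w₂ → w₂ + w₃ ≡ 2 * e₁ + e₂ →
                 Σ ℕ λ k → Σ ℕ λ r → k + r ≡ e₂ × w₂ ≡ e₁ + k × w₃ ≡ e₁ + r
  weight-split {e₁} {e₂} {w₂} {w₃} w₂≤e₁+e₂ w₃≤w₂ total =
    w₂ ∸ e₁ , w₃ ∸ e₁ , k+r≡e₂ , sym (m+[n∸m]≡n e₁≤w₂) , sym (m+[n∸m]≡n e₁≤w₃)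
    where
    e₁≤w₃ : e₁ ≤ w₃
    e₁≤w₃ = +-cancelˡ-≤ (e₁ + e₂) e₁ w₃
      (≤-trans (≤-reflexive (trans (arith e₁ e₂) (sym total))) (+-monoˡ-≤ w₃ w₂≤e₁+e₂))
      where
      arith : ∀ a b → a + b + a ≡ 2 * a + b
      arith = solve-∀
    e₁≤w₂ : e₁ ≤ w₂
    e₁≤w₂ = ≤-trans e₁≤w₃ w₃≤w₂
    k+r≡e₂ : w₂ ∸ e₁ + (w₃ ∸ e₁) ≡ e₂
    k+r≡e₂ = +-cancelˡ-≡ (e₁ + e₁) _ e₂ (begin
      e₁ + e₁ + (w₂ ∸ e₁ + (w₃ ∸ e₁))      ≡⟨ arith e₁ (w₂ ∸ e₁) (w₃ ∸ e₁) ⟩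
      e₁ + (w₂ ∸ e₁) + (e₁ + (w₃ ∸ e₁))    ≡⟨ cong₂ _+_ (m+[n∸m]≡n e₁≤w₂) (m+[n∸m]≡n e₁≤w₃) ⟩
      w₂ + w₃                              ≡⟨ total ⟩
      2 * e₁ + e₂                          ≡⟨ arith′ e₁ e₂ ⟩
      e₁ + e₁ + e₂                         ∎)
      where
      arith : ∀ a k r → a + a + (k + r) ≡ a + k + (a + r)
      arith = solve-∀
      arith′ : ∀ a b → 2 * a + b ≡ a + a + b
      arith′ = solve-∀

  place : {M m : ℕ} → (Fin 3 → Maybe (Fin m)) → Vector (Fin M) m → Triple M
  place σ B k = Maybe.map B (σ k)

  all-three : Fin 3 → Maybe (Fin 3)
  all-three = just

  first-second : Fin 3 → Maybe (Fin 2)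
  first-second = just 0F ∷ᵛ just 1F ∷ᵛ nothing ∷ᵛ []ᵛ

  first-third : Fin 3 → Maybe (Fin 2)
  first-third = just 0F ∷ᵛ nothing ∷ᵛ just 1F ∷ᵛ []ᵛ

  distinct-all-three : Distinct all-three
  distinct-all-three k l j k≡j l≡j = trans (just-injective k≡j) (sym (just-injective l≡j))

  distinct-first-second : Distinct first-second
  distinct-first-second 0F 0F _ _ _ = refl
  distinct-first-second 1F 1F _ _ _ = refl
  distinct-first-second 0F 1F _ refl ()
  distinct-first-second 1F 0F _ refl ()
  distinct-first-second 0F 2F _ _ ()
  distinct-first-second 1F 2F _ _ ()
  distinct-first-second 2F _ _ () _

  distinct-first-third : Distinct first-third
  distinct-first-third 0F 0F _ _ _ = refl
  distinct-first-third 2F 2F _ _ _ = refl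
  distinct-first-third 0F 2F _ refl ()
  distinct-first-third 2F 0F _ refl ()
  distinct-first-third 0F 1F _ _ ()
  distinct-first-third 2F 1F _ _ ()
  distinct-first-third 1F _ _ () _

  filled-map : {A B : Set} (f : A → B) (m : Maybe A) → filled (Maybe.map f m) ≡ filled m
  filled-map f (just _) = refl
  filled-map f nothing = refl

  column-++ : {M : ℕ} (i : Fin 3) (xs ys : List (Triple M)) → column i (xs ++ ys) ≡ column i xs + column i ys
  column-++ i xs ys = trans (cong sum (map-++ _ xs ys)) (sum-++ (map _ xs) _)

  column-place : {M m : ℕ} (i : Fin 3) (σ : Fin 3 → Maybe (Fin m)) (Bs : List (Vector (Fin M) m)) →
                 column i (map (place σ) Bs) ≡ length Bs * filled (σ i)
  column-place i σ [] = refl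
  column-place i σ (B ∷ Bs) = cong₂ _+_ (filled-map B (σ i)) (column-place i σ Bs)

  column-values : ∀ {e₁ e₂ w₂ w₃ k r} → k + r ≡ e₂ → w₂ ≡ e₁ + k → w₃ ≡ e₁ + r → ∀ i →
    e₁ * filled (all-three i) + (k * filled (first-second i) + r * filled (first-third i))
      ≡ ((e₁ + e₂) ∷ᵛ w₂ ∷ᵛ w₃ ∷ᵛ []ᵛ) i
  column-values {e₁} {k = k} {r} refl refl refl 0F = arith e₁ k r
    where arith : ∀ a k r → a * 1 + (k * 1 + r * 1) ≡ a + (k + r)
          arith = solve-∀
  column-values {e₁} {k = k} {r} refl refl refl 1F = arith e₁ k r
    where arith : ∀ a k r → a * 1 + (k * 1 + r * 0) ≡ a + k
          arith = solve-∀
  column-values {e₁} {k = k} {r} refl refl refl 2F = arith e₁ k r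
    where arith : ∀ a k r → a * 1 + (k * 0 + r * 1) ≡ a + r
          arith = solve-∀

  positive : {n : ℕ} → Fin n → 0 < n
  positive i = <-≤-trans (s≤s z≤n) (toℕ<n i)

  module BaseFamily {M e₁ e₂ : ℕ} .{{_ : NonZero M}} (G : GDP M e₁ e₂) (k r : ℕ) (k+r≡e₂ : k + r ≡ e₂) where

    open GDP G

    triples pairs : List _
    triples = toList blocks3
    pairs = toList blocks2

    base : List (Triple M)
    base = map (place all-three) triples ++
           (map (place first-second) (take k pairs) ++ map (place first-third) (drop k pairs))

    take-length : length (take k pairs) ≡ k
    take-length = begin
      length (take k pairs)  ≡⟨ length-take k pairs ⟩
      k ⊓ length pairs       ≡⟨ cong (k ⊓_) (trans (length-toList blocks2) (sym k+r≡e₂)) ⟩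
      k ⊓ (k + r)            ≡⟨ m≤n⇒m⊓n≡m (m≤m+n k r) ⟩
      k                      ∎

    drop-length : length (drop k pairs) ≡ r
    drop-length = begin
      length (drop k pairs)  ≡⟨ length-drop k pairs ⟩
      length pairs ∸ k       ≡⟨ cong (_∸ k) (trans (length-toList blocks2) (sym k+r≡e₂)) ⟩
      k + r ∸ k              ≡⟨ m+n∸m≡n k r ⟩
      r                      ∎

    additive-on-base : (F : List (Triple M) → ℕ) → (∀ xs ys → F (xs ++ ys) ≡ F xs + F ys) →
      F base ≡ F (map (place all-three) triples) +
               (F (map (place first-second) (take k pairs)) + F (map (place first-third) (drop k pairs)))
    additive-on-base F F-++ = trans (F-++ (map (place all-three) triples) _)
      (cong (F (map (place all-three) triples) +_) (F-++ (map (place first-second) (take k pairs)) _))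

    base-length : length base ≡ e₁ + e₂
    base-length = begin
      length base
        ≡⟨ additive-on-base length (λ xs ys → length-++ xs) ⟩
      length (map (place all-three) triples) +
        (length (map (place first-second) (take k pairs)) + length (map (place first-third) (drop k pairs)))
        ≡⟨ cong₂ _+_ (length-map _ triples) (cong₂ _+_ (length-map _ (take k pairs)) (length-map _ (drop k pairs))) ⟩
      length triples + (length (take k pairs) + length (drop k pairs))
        ≡⟨ cong₂ _+_ (length-toList blocks3) (cong₂ _+_ take-length drop-length) ⟩
      e₁ + (k + r)
        ≡⟨ cong (e₁ +_) k+r≡e₂ ⟩
      e₁ + e₂
        ∎

    base-column : ∀ i → column i base ≡
      e₁ * filled (all-three i) + (k * filled (first-second i) + r * filled (first-third i))
    base-column i = begin
      column i base
        ≡⟨ additive-on-base (column i) (column-++ i) ⟩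
      column i (map (place all-three) triples) +
        (column i (map (place first-second) (take k pairs)) + column i (map (place first-third) (drop k pairs)))
        ≡⟨ cong₂ _+_ (column-place i all-three triples)
                     (cong₂ _+_ (column-place i first-second (take k pairs)) (column-place i first-third (drop k pairs))) ⟩
      length triples * filled (all-three i) +
        (length (take k pairs) * filled (first-second i) + length (drop k pairs) * filled (first-third i))
        ≡⟨ cong₂ (λ a bc → a * filled (all-three i) + bc) (length-toList blocks3)
                 (cong₂ (λ b c → b * filled (first-second i) + c * filled (first-third i)) take-length drop-length) ⟩
      e₁ * filled (all-three i) + (k * filled (first-second i) + r * filled (first-third i))
        ∎

    base-distinct : All Distinct base
    base-distinct = ++⁺ (placed distinct-all-three (toList⁺ (lookup⁻ {xs = blocks3} blocks3-subset)))
      (++⁺ (placed distinct-first-second (take⁺ k injective-pairs))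
           (placed distinct-first-third (drop⁺ k injective-pairs)))
      where
      placed : ∀ {m} {σ : Fin 3 → Maybe (Fin m)} {Bs} → Distinct σ →
               All (Injective _≡_ _≡_) Bs → All Distinct (map (place {M} σ) Bs)
      placed distinct-σ injective = map⁺ (All.map {P = Injective _≡_ _≡_} (λ B-inj → distinct-map B-inj distinct-σ) injective)
      injective-pairs : All (Injective _≡_ _≡_) pairs
      injective-pairs = toList⁺ (lookup⁻ {xs = blocks2} blocks2-subset)

    base-differences : concatMap differences base ≡
      concat (toList (V.map diffs3 blocks3)) ++ concat (toList (V.map diffs2 blocks2))
    base-differences = begin
      concatMap differences base
        ≡⟨ concatMap-++ differences (map (place all-three) triples) _ ⟩
      concatMap differences (map (place all-three) triples) ++
        concatMap differences (map (place first-second) (take k pairs) ++ map (place first-third) (drop k pairs))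
        ≡⟨ cong₂ _++_ (concatMap-map differences (place all-three) triples) pair-differences ⟩
      concatMap diffs3 triples ++ concatMap diffs2 pairs
        ≡⟨ cong₂ _++_ (cong concat (sym (toList-map diffs3 blocks3))) (cong concat (sym (toList-map diffs2 blocks2))) ⟩
      concat (toList (V.map diffs3 blocks3)) ++ concat (toList (V.map diffs2 blocks2))
        ∎
      where
      pair-differences : concatMap differences (map (place first-second) (take k pairs) ++ map (place first-third) (drop k pairs))
                         ≡ concatMap diffs2 pairs
      pair-differences = begin
        concatMap differences (map (place first-second) (take k pairs) ++ map (place first-third) (drop k pairs))
          ≡⟨ concatMap-++ differences (map (place first-second) (take k pairs)) _ ⟩
        concatMap differences (map (place first-second) (take k pairs)) ++
          concatMap differences (map (place first-third) (drop k pairs))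
          ≡⟨ cong₂ _++_ (concatMap-map differences (place first-second) (take k pairs))
                        (concatMap-map differences (place first-third) (drop k pairs)) ⟩
        concatMap diffs2 (take k pairs) ++ concatMap diffs2 (drop k pairs)
          ≡⟨ concatMap-++ diffs2 (take k pairs) (drop k pairs) ⟨
        concatMap diffs2 (take k pairs ++ drop k pairs)
          ≡⟨ cong (concatMap diffs2) (take++drop≡id k pairs) ⟩
        concatMap diffs2 pairs
          ∎

    base-unique : Unique (concatMap differences base)
    base-unique = subst Unique (sym base-differences) differences-unique

    base-fits : ∀ {w₂ w₃} → w₂ + w₃ ≡ 2 * e₁ + e₂ → All (FitsLimit (limit ((e₁ + e₂) ∷ᵛ w₂ ∷ᵛ w₃ ∷ᵛ []ᵛ))) base
    base-fits {w₂} {w₃} total = ++⁺ (map⁺ triples-fit) (++⁺ (map⁺ (take⁺ k pairs-fit)) (map⁺ (drop⁺ k pairs-fit)))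
      where
      lim = limit ((e₁ + e₂) ∷ᵛ w₂ ∷ᵛ w₃ ∷ᵛ []ᵛ)
      triples-fit : All (λ _ → 3 ≡ lim ⊎ 3 ≡ lim ∸ 1) triples
      triples-fit = toList⁺ (lookup⁻ (λ i → inj₁ (sym (limit-with-triples {e₁} {e₂} {w₂} {w₃} total (positive i)))))
      pairs-fit : All (λ _ → 2 ≡ lim ⊎ 2 ≡ lim ∸ 1) pairs
      pairs-fit = toList⁺ (lookup⁻ (λ i → limit-with-pairs {e₁} {e₂} {w₂} {w₃} total (positive i)))


open import Defs
open import Data.Nat using (ℕ; _+_; _*_; _≤_; NonZero)
open import Data.List using (List; length)
open import Data.Vec.Functional using (Vector; []; _∷_)
open import Data.Product using (Σ; _×_; _,_)
open import Relation.Binary.PropositionalEquality using (_≡_; trans; cong)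
open Development using (develop; develop-length; column; developed-packing)
open GDPBaseTriples using (weight-split; column-values; module BaseFamily)

proposition11 : (M : ℕ) .{{_ : NonZero M}} (e₁ e₂ w₂ w₃ : ℕ) →
    GDP M e₁ e₂ →
    w₂ ≤ e₁ + e₂ → w₃ ≤ w₂ → w₂ + w₃ ≡ 2 * e₁ + e₂ →
    Σ (List (Triple M)) (λ 𝒜 →
    length 𝒜 ≡ (e₁ + e₂) * M ×
    Balanced M ((e₁ + e₂) ∷ w₂ ∷ w₃ ∷ []) 𝒜)
proposition11 M e₁ e₂ w₂ w₃ G w₂≤e₁+e₂ w₃≤w₂ total with weight-split w₂≤e₁+e₂ w₃≤w₂ total
... | k , r , k+r≡e₂ , w₂≡e₁+k , w₃≡e₁+r =
  develop base , size , developed-packing w base base-distinct (base-fits total) base-unique columns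
  where
  open BaseFamily G k r k+r≡e₂
  w : Vector ℕ 3
  w = (e₁ + e₂) ∷ w₂ ∷ w₃ ∷ []
  size : length (develop base) ≡ (e₁ + e₂) * M
  size = trans (develop-length base) (cong (_* M) base-length)
  columns : ∀ i → column i base ≡ w i
  columns i = trans (base-column i) (column-values k+r≡e₂ w₂≡e₁+k w₃≡e₁+r i)
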